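{- Let $D=(V,A)$ be a digraph with arc weights $w\in\{0,1\}^A$ such that the minimum weight of a dicut is $\tau\ge 2$. Let $e\in A$ with $w_e=1$. If there exists $\emptyset\ne U\subsetneq V$ such that $\delta^+_D(U)=\{e\}$ and $w(\delta^-_D(U))=0$, then $e$ is not contained in any dicut of minimum weight.
   Context: $\delta^+_D(U)$ and $\delta^-_D(U)$ are the sets of arcs leaving and entering $U$; $w(F)=\sum_{a\in F}w_a$. A dicut is an arc set $\delta^-_D(W)$ with $\emptyset\ne W\subsetneq V$ and $\delta^+_D(W)=\emptyset$ (all arcs of the cut cross in one direction); its weight is the sum of $w$ over its arcs. -}

module Defs where

open import Data.Nat using (ℕ; _≤_)
open import Data.Fin using (Fin)
open import Data.Bool using (Bool; true; false; _∧_; not; if_then_else_)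
open import Data.List using (map; allFin)
open import Data.Nat.ListAction using (sum)
open import Data.Product using (_×_; ∃)
open import Relation.Binary.PropositionalEquality using (_≡_)
open import Function.Bundles using (_⇔_)

-- A digraph D = (V, A) with V = Fin n and A = Fin m (parallel arcs and
-- loops allowed); arc a goes from tail a to head a.
record Digraph : Set where
  field
    n    : ℕ
    m    : ℕ
    tail : Fin m → Fin n
    head : Fin m → Fin n

open Digraph public

VSet : Digraph → Set
VSet D = Fin (n D) → Bool

leaves : (D : Digraph) → VSet D → Fin (m D) → Bool
leaves D U a = U (tail D a) ∧ not (U (head D a))

enters : (D : Digraph) → VSet D → Fin (m D) → Bool
enters D U a = U (head D a) ∧ not (U (tail D a))

NonTrivial : (D : Digraph) → VSet D → Set
NonTrivial D U = (∃ λ v → U v ≡ true) × (∃ λ v → U v ≡ false)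

-- W is the shore of a dicut δ⁻(W): ∅ ≠ W ⊊ V and δ⁺(W) = ∅.
IsDicutShore : (D : Digraph) → VSet D → Set
IsDicutShore D W = NonTrivial D W × (∀ a → leaves D W a ≡ false)

inWeight : (D : Digraph) → (Fin (m D) → ℕ) → VSet D → ℕ
inWeight D w U = sum (map (λ a → if enters D U a then w a else 0) (allFin (m D)))

MinDicutWeight : (D : Digraph) → (Fin (m D) → ℕ) → ℕ → Set
MinDicutWeight D w τ =
  (∃ λ W → IsDicutShore D W × inWeight D w W ≡ τ) ×
  (∀ W → IsDicutShore D W → τ ≤ inWeight D w W)

ZeroOne : (D : Digraph) → (Fin (m D) → ℕ) → Set
ZeroOne D w = ∀ a → w a ≤ 1

-- If e entered the minimum dicut shore W, then W ∪ U and W ∩ U would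
-- again have no leaving arcs (the only arc leaving U has its head in W and its
-- tail outside W), and by submodularity of the in-cut weight, with e counted on
-- the right but on neither cut on the left, w(δ⁻(W ∪ U)) + w(δ⁻(W ∩ U)) < τ + 0.
-- Hence neither W ∪ U nor W ∩ U is a dicut shore, i.e. W ∪ U = V and W ∩ U = ∅;
-- but then W is the complement of U and δ⁻(W) = δ⁺(U) = {e} has weight 1 < τ.
module Submission where

open import Defs
open import Data.Nat using (ℕ; zero; suc; _+_; _*_; _≤_; _<_; z≤n)
open import Data.Nat.Properties
  using ( +-mono-≤; +-mono-<-≤; +-identityʳ; *-identityˡ; *-distribʳ-+; *-monoˡ-≤
        ; ≤-refl; ≤-trans; m≤m+n; <⇒≱; m≤n+m; module ≤-Reasoning; +-0-commutativeMonoid )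
open import Data.Fin using (Fin; zero; suc; punchIn)
open import Data.Fin.Properties using (any?; punchInᵢ≢i)
open import Data.Bool using (Bool; true; false; _∧_; _∨_; not; if_then_else_; _≟_)
open import Data.Bool.Properties using (∧-comm; ∧-zeroʳ; ∨-zeroʳ; not-involutive; ¬-not)
open import Data.List using (tabulate)
open import Data.List.Properties using (map-tabulate)
open import Data.Nat.ListAction using (sum)
open import Data.Vec.Functional using (removeAt; replicate)
open import Data.Product using (_×_; _,_; ∃; proj₁; proj₂)
open import Data.Sum using (_⊎_; inj₁; inj₂)
open import Function using (_∘_; id)
open import Function.Bundles using (_⇔_; Equivalence)
open import Relation.Binary.PropositionalEquality
open import Relation.Nullary using (yes; no; contradiction)
open import Algebra.Properties.CommutativeMonoid.Sum +-0-commutativeMonoid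
  using (sum-remove; ∑-distrib-+; sum-cong-≗; sum-replicate-zero)
  renaming (sum to ∑)

∑-tabulate : ∀ {k} (f : Fin k → ℕ) → sum (tabulate f) ≡ ∑ f
∑-tabulate {zero}  f = refl
∑-tabulate {suc k} f = cong (f zero +_) (∑-tabulate (f ∘ suc))

∑-mono-≤ : ∀ {k} {f g : Fin k → ℕ} → (∀ i → f i ≤ g i) → ∑ f ≤ ∑ g
∑-mono-≤ {zero}  f≤g = z≤n
∑-mono-≤ {suc k} f≤g = +-mono-≤ (f≤g zero) (∑-mono-≤ (f≤g ∘ suc))

∑-mono-< : ∀ {k} {f g : Fin k → ℕ} → (∀ i → f i ≤ g i) → ∀ i → f i < g i → ∑ f < ∑ g
∑-mono-< {suc k} {f} {g} f≤g i fᵢ<gᵢ = begin-strict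
  ∑ f                    ≡⟨ sum-remove f ⟩
  f i + ∑ (removeAt f i) <⟨ +-mono-<-≤ fᵢ<gᵢ (∑-mono-≤ (f≤g ∘ punchIn i)) ⟩
  g i + ∑ (removeAt g i) ≡⟨ sum-remove g ⟨
  ∑ g                    ∎
  where open ≤-Reasoning

∑-single : ∀ {k} (f : Fin k → ℕ) i → (∀ j → j ≢ i → f j ≡ 0) → ∑ f ≡ f i
∑-single {suc k} f i f≡0 = begin
  ∑ f                    ≡⟨ sum-remove f ⟩
  f i + ∑ (removeAt f i) ≡⟨ cong (f i +_) (sum-cong-≗ {y = replicate k 0} (λ j → f≡0 _ (punchInᵢ≢i i j))) ⟩
  f i + ∑ (replicate k 0) ≡⟨ cong (f i +_) (sum-replicate-zero k) ⟩
  f i + 0                ≡⟨ +-identityʳ (f i) ⟩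
  f i                    ∎
  where open ≡-Reasoning

𝟙 : Bool → ℕ
𝟙 b = if b then 1 else 0

if-then-0≡𝟙* : ∀ b x → (if b then x else 0) ≡ 𝟙 b * x
if-then-0≡𝟙* true  x = sym (*-identityˡ x)
if-then-0≡𝟙* false x = refl

if-then-0-+-mono : ∀ b₁ b₂ c₁ c₂ x → 𝟙 b₁ + 𝟙 b₂ ≤ 𝟙 c₁ + 𝟙 c₂ →
  (if b₁ then x else 0) + (if b₂ then x else 0) ≤ (if c₁ then x else 0) + (if c₂ then x else 0)
if-then-0-+-mono b₁ b₂ c₁ c₂ x count≤ = begin
  (if b₁ then x else 0) + (if b₂ then x else 0) ≡⟨ cong₂ _+_ (if-then-0≡𝟙* b₁ x) (if-then-0≡𝟙* b₂ x) ⟩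
  𝟙 b₁ * x + 𝟙 b₂ * x                           ≡⟨ *-distribʳ-+ x (𝟙 b₁) (𝟙 b₂) ⟨
  (𝟙 b₁ + 𝟙 b₂) * x                             ≤⟨ *-monoˡ-≤ x count≤ ⟩
  (𝟙 c₁ + 𝟙 c₂) * x                             ≡⟨ *-distribʳ-+ x (𝟙 c₁) (𝟙 c₂) ⟩
  𝟙 c₁ * x + 𝟙 c₂ * x                           ≡⟨ cong₂ _+_ (if-then-0≡𝟙* c₁ x) (if-then-0≡𝟙* c₂ x) ⟨
  (if c₁ then x else 0) + (if c₂ then x else 0) ∎
  where open ≤-Reasoning

_∪_ _∩_ : ∀ {A : Set} → (A → Bool) → (A → Bool) → A → Bool
(W ∪ U) v = W v ∨ U v
(W ∩ U) v = W v ∧ U v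

-- Arguments: membership of tail and head in W, then in U.
crossing-count : ∀ wₜ wₕ uₜ uₕ →
  𝟙 ((wₕ ∨ uₕ) ∧ not (wₜ ∨ uₜ)) + 𝟙 ((wₕ ∧ uₕ) ∧ not (wₜ ∧ uₜ)) ≤ 𝟙 (wₕ ∧ not wₜ) + 𝟙 (uₕ ∧ not uₜ)
crossing-count true  true  true  true  = ≤-refl
crossing-count true  true  true  false = ≤-refl
crossing-count true  true  false true  = ≤-refl
crossing-count true  true  false false = ≤-refl
crossing-count true  false true  true  = ≤-refl
crossing-count true  false true  false = ≤-refl
crossing-count true  false false true  = z≤n
crossing-count true  false false false = ≤-refl
crossing-count false true  true  true  = ≤-refl
crossing-count false true  true  false = z≤n
crossing-count false true  false true  = ≤-refl
crossing-count false true  false false = ≤-refl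
crossing-count false false true  true  = ≤-refl
crossing-count false false true  false = ≤-refl
crossing-count false false false true  = ≤-refl
crossing-count false false false false = ≤-refl

∧-not≡true : ∀ {x y} → x ∧ not y ≡ true → x ≡ true × y ≡ false
∧-not≡true {true} {false} _ = refl , refl

∨∧-complement : ∀ {x y} → x ∨ y ≡ true → x ∧ y ≡ false → x ≡ not y
∨∧-complement {true}  {false} _ _ = refl
∨∧-complement {false} {true}  _ _ = refl

∃≡⊎∀≡not : ∀ {k} (X : Fin k → Bool) b → (∃ λ v → X v ≡ b) ⊎ (∀ v → X v ≡ not b)
∃≡⊎∀≡not X b with any? (λ v → X v ≟ b)
... | yes found = inj₁ found
... | no none   = inj₂ λ v → ¬-not λ Xv≡b → none (v , Xv≡b)

∪-closed-at : ∀ wₜ wₕ uₜ uₕ → wₜ ∧ not wₕ ≡ false → (uₜ ∧ not uₕ ≡ true → wₕ ∧ not wₜ ≡ true) →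
  (wₜ ∨ uₜ) ∧ not (wₕ ∨ uₕ) ≡ false
∪-closed-at wₜ    true  uₜ    uₕ    _  _       = ∧-zeroʳ (wₜ ∨ uₜ)
∪-closed-at true  false _     _     () _
∪-closed-at false false true  true  _  _       = refl
∪-closed-at false false true  false _  exits-W = contradiction (exits-W refl) λ ()
∪-closed-at false false false _     _  _       = refl

∩-closed-at : ∀ wₜ wₕ uₜ uₕ → wₜ ∧ not wₕ ≡ false → (uₜ ∧ not uₕ ≡ true → wₕ ∧ not wₜ ≡ true) →
  (wₜ ∧ uₜ) ∧ not (wₕ ∧ uₕ) ≡ false
∩-closed-at false _     _     _     _  _       = refl
∩-closed-at true  false _     _     () _
∩-closed-at true  true  true  true  _  _       = refl
∩-closed-at true  true  true  false _  exits-W = contradiction (exits-W refl) λ ()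
∩-closed-at true  true  false _     _  _       = refl

module _ (D : Digraph) where

  inCost : (Fin (m D) → ℕ) → VSet D → Fin (m D) → ℕ
  inCost w U a = if enters D U a then w a else 0

  inWeight≡∑inCost : ∀ w U → inWeight D w U ≡ ∑ (inCost w U)
  inWeight≡∑inCost w U = trans (cong sum (map-tabulate id (inCost w U))) (∑-tabulate (inCost w U))

  inCost-submodular : ∀ w (W U : VSet D) a →
    inCost w (W ∪ U) a + inCost w (W ∩ U) a ≤ inCost w W a + inCost w U a
  inCost-submodular w W U a = if-then-0-+-mono
    (enters D (W ∪ U) a) (enters D (W ∩ U) a) (enters D W a) (enters D U a) (w a)
    (crossing-count (W (tail D a)) (W (head D a)) (U (tail D a)) (U (head D a)))

  tail∈U⇒¬enters-∪ : ∀ (W U : VSet D) a → U (tail D a) ≡ true → enters D (W ∪ U) a ≡ false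
  tail∈U⇒¬enters-∪ W U a tail∈U rewrite tail∈U | ∨-zeroʳ (W (tail D a)) = ∧-zeroʳ _

  head∉U⇒¬enters-∩ : ∀ (W U : VSet D) a → U (head D a) ≡ false → enters D (W ∩ U) a ≡ false
  head∉U⇒¬enters-∩ W U a head∉U rewrite head∉U | ∧-zeroʳ (W (head D a)) = refl

  inWeight-uncrossing : ∀ w (W U : VSet D) e → enters D W e ≡ true → leaves D U e ≡ true → 0 < w e →
    inWeight D w (W ∪ U) + inWeight D w (W ∩ U) < inWeight D w W + inWeight D w U
  inWeight-uncrossing w W U e e∈δ⁻W e∈δ⁺U 0<wₑ = begin-strict
    inWeight D w (W ∪ U) + inWeight D w (W ∩ U)
      ≡⟨ cong₂ _+_ (inWeight≡∑inCost w (W ∪ U)) (inWeight≡∑inCost w (W ∩ U)) ⟩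
    ∑ (inCost w (W ∪ U)) + ∑ (inCost w (W ∩ U))  ≡⟨ ∑-distrib-+ (inCost w (W ∪ U)) (inCost w (W ∩ U)) ⟨
    ∑ (λ a → inCost w (W ∪ U) a + inCost w (W ∩ U) a)
      <⟨ ∑-mono-< (inCost-submodular w W U) e e-uncounted ⟩
    ∑ (λ a → inCost w W a + inCost w U a)        ≡⟨ ∑-distrib-+ (inCost w W) (inCost w U) ⟩
    ∑ (inCost w W) + ∑ (inCost w U)              ≡⟨ cong₂ _+_ (inWeight≡∑inCost w W) (inWeight≡∑inCost w U) ⟨
    inWeight D w W + inWeight D w U              ∎
    where
    open ≤-Reasoning
    costₑ : ∀ {b} → b ≡ false → (if b then w e else 0) ≡ 0
    costₑ refl = refl
    e-uncounted : inCost w (W ∪ U) e + inCost w (W ∩ U) e < inCost w W e + inCost w U e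
    e-uncounted = begin-strict
      inCost w (W ∪ U) e + inCost w (W ∩ U) e
        ≡⟨ cong₂ _+_ (costₑ (tail∈U⇒¬enters-∪ W U e (proj₁ (∧-not≡true e∈δ⁺U))))
                     (costₑ (head∉U⇒¬enters-∩ W U e (proj₂ (∧-not≡true e∈δ⁺U)))) ⟩
      0                               <⟨ 0<wₑ ⟩
      w e                             ≡⟨ cong (λ b → if b then w e else 0) e∈δ⁻W ⟨
      inCost w W e                    ≤⟨ m≤m+n (inCost w W e) (inCost w U e) ⟩
      inCost w W e + inCost w U e     ∎

  ∪∩-shore-or-complement : ∀ (W U : VSet D) → IsDicutShore D W →
    (∀ a → leaves D U a ≡ true → enters D W a ≡ true) →
    IsDicutShore D (W ∪ U) ⊎ IsDicutShore D (W ∩ U) ⊎ (∀ v → W v ≡ not (U v))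
  ∪∩-shore-or-complement W U (((v , v∈W) , (v′ , v′∉W)) , W-closed) δ⁺U⊆δ⁻W
    with ∃≡⊎∀≡not (W ∪ U) false | ∃≡⊎∀≡not (W ∩ U) true
  ... | inj₁ ∪-misses | _ = inj₁ (((v , cong (_∨ U v) v∈W) , ∪-misses) , ∪-closed)
    where
    ∪-closed : ∀ a → leaves D (W ∪ U) a ≡ false
    ∪-closed a = ∪-closed-at (W (tail D a)) (W (head D a)) (U (tail D a)) (U (head D a))
      (W-closed a) (δ⁺U⊆δ⁻W a)
  ... | inj₂ _ | inj₁ ∩-hits = inj₂ (inj₁ ((∩-hits , (v′ , cong (_∧ U v′) v′∉W)) , ∩-closed))
    where
    ∩-closed : ∀ a → leaves D (W ∩ U) a ≡ false
    ∩-closed a = ∩-closed-at (W (tail D a)) (W (head D a)) (U (tail D a)) (U (head D a))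
      (W-closed a) (δ⁺U⊆δ⁻W a)
  ... | inj₂ ∪-full | inj₂ ∩-empty = inj₂ (inj₂ λ u → ∨∧-complement (∪-full u) (∩-empty u))

  complement⇒enters≡leaves : ∀ (W U : VSet D) → (∀ v → W v ≡ not (U v)) →
    ∀ a → enters D W a ≡ leaves D U a
  complement⇒enters≡leaves W U W≡∁U a
    rewrite W≡∁U (head D a) | W≡∁U (tail D a) | not-involutive (U (tail D a))
    = ∧-comm (not (U (head D a))) (U (tail D a))

  inWeight-complement-of-single-exit : ∀ w (W U : VSet D) e → (∀ v → W v ≡ not (U v)) →
    (∀ a → (leaves D U a ≡ true) ⇔ (a ≡ e)) → inWeight D w W ≡ w e
  inWeight-complement-of-single-exit w W U e W≡∁U δ⁺U≡e = begin
    inWeight D w W  ≡⟨ inWeight≡∑inCost w W ⟩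
    ∑ (inCost w W)  ≡⟨ ∑-single (inCost w W) e cost-off-e ⟩
    inCost w W e    ≡⟨ cong (λ b → if b then w e else 0) (trans (enters-W e) (Equivalence.from (δ⁺U≡e e) refl)) ⟩
    w e             ∎
    where
    open ≡-Reasoning
    enters-W = complement⇒enters≡leaves W U W≡∁U
    cost-off-e : ∀ a → a ≢ e → inCost w W a ≡ 0
    cost-off-e a a≢e = cong (λ b → if b then w a else 0)
      (trans (enters-W a) (¬-not (a≢e ∘ Equivalence.to (δ⁺U≡e a))))

lemma2 : (D : Digraph) (w : Fin (m D) → ℕ) (τ : ℕ) →
    ZeroOne D w → MinDicutWeight D w τ → 2 ≤ τ →
    (e : Fin (m D)) → w e ≡ 1 →
    (U : VSet D) → NonTrivial D U →
    (∀ a → (leaves D U a ≡ true) ⇔ (a ≡ e)) →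
    inWeight D w U ≡ 0 →
    ∀ W → IsDicutShore D W → inWeight D w W ≡ τ → enters D W e ≡ false
lemma2 D w τ _ (_ , τ-min) 2≤τ e wₑ≡1 U _ δ⁺U≡e wU≡0 W W-shore wW≡τ = ¬-not e∉δ⁻W
  where
  uncrossed<τ : enters D W e ≡ true → inWeight D w (W ∪ U) + inWeight D w (W ∩ U) < τ
  uncrossed<τ e∈δ⁻W = subst (_ <_) (trans (cong₂ _+_ wW≡τ wU≡0) (+-identityʳ τ))
    (inWeight-uncrossing D w W U e e∈δ⁻W (Equivalence.from (δ⁺U≡e e) refl) (subst (0 <_) (sym wₑ≡1) ≤-refl))

  e∉δ⁻W : enters D W e ≢ true
  e∉δ⁻W e∈δ⁻W with ∪∩-shore-or-complement D W U W-shore δ⁺U⊆δ⁻W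
    where
    δ⁺U⊆δ⁻W : ∀ a → leaves D U a ≡ true → enters D W a ≡ true
    δ⁺U⊆δ⁻W a a∈δ⁺U with refl ← Equivalence.to (δ⁺U≡e a) a∈δ⁺U = e∈δ⁻W
  ... | inj₁ ∪-shore        = <⇒≱ (uncrossed<τ e∈δ⁻W) (≤-trans (τ-min _ ∪-shore) (m≤m+n _ _))
  ... | inj₂ (inj₁ ∩-shore) = <⇒≱ (uncrossed<τ e∈δ⁻W) (≤-trans (τ-min _ ∩-shore) (m≤n+m _ _))
  ... | inj₂ (inj₂ W≡∁U)    = <⇒≱ (subst (_< 2) 1≡τ ≤-refl) 2≤τ
    where
    1≡τ : 1 ≡ τ
    1≡τ = trans (sym wₑ≡1) (trans (sym (inWeight-complement-of-single-exit D w W U e W≡∁U δ⁺U≡e)) wW≡τ)
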